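{- Let $k\ge 2$, let $G$ be a graph and let $c:V(G)\to\{1,\dots,k\}$ be a coloring whose color classes satisfy $|V_1|=|V_2|=\cdots=|V_k|$. Then $c$ is a neighborhood balanced $k$-coloring of $G$ if and only if $c$ is a closed neighborhood balanced $k$-coloring of the complement $\overline{G}$.
   Context: All graphs are finite and simple. For a vertex $v$, $N(v)$ is its set of neighbors and $N[v]=N(v)\cup\{v\}$. Color classes are $V_i=c^{ -1}(i)$. A neighborhood balanced $k$-coloring of a graph is a map $c$ to $\{1,\dots,k\}$ using all $k$ colors such that for every vertex $v$ the numbers $|N(v)\cap c^{ -1}(i)|$, $i=1,\dots,k$, are all equal. A closed neighborhood balanced $k$-coloring is a map $c$ to $\{1,\dots,k\}$ such that for every vertex $v$ the numbers $|N[v]\cap c^{ -1}(i)|$, $i=1,\dots,k$, are all equal (neighborhoods taken in the graph in question). -}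

module Defs where

open import Data.Nat using (ℕ; zero; suc; _+_; _≤_)
open import Data.Fin using (Fin; zero; suc)
open import Data.Bool using (Bool; true; false; not; _∧_; _∨_)
open import Data.Product using (_×_; ∃)
open import Relation.Binary.PropositionalEquality using (_≡_)
open import Relation.Nullary using (¬_)

countF : ∀ {n} → (Fin n → Bool) → ℕ
countF {zero} p = 0
countF {suc n} p with p zero
... | true  = suc (countF (λ i → p (suc i)))
... | false = countF (λ i → p (suc i))

eqF : ∀ {n} → Fin n → Fin n → Bool
eqF zero zero = true
eqF zero (suc _) = false
eqF (suc _) zero = false
eqF (suc i) (suc j) = eqF i j

record Graph (n : ℕ) : Set where
  field
    adj   : Fin n → Fin n → Bool
    sym   : ∀ u v → adj u v ≡ adj v u
    irrefl : ∀ v → adj v v ≡ false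
open Graph public

complement : ∀ {n} → Graph n → Graph n
complement G = record
  { adj = λ u v → not (eqF u v) ∧ not (adj G u v)
  ; sym = symC
  ; irrefl = irr
  }
  where
  eqF-sym : ∀ {m} (u v : Fin m) → eqF u v ≡ eqF v u
  eqF-sym zero zero = Relation.Binary.PropositionalEquality.refl
  eqF-sym zero (suc _) = Relation.Binary.PropositionalEquality.refl
  eqF-sym (suc _) zero = Relation.Binary.PropositionalEquality.refl
  eqF-sym (suc u) (suc v) = eqF-sym u v
  eqF-refl : ∀ {m} (v : Fin m) → eqF v v ≡ true
  eqF-refl zero = Relation.Binary.PropositionalEquality.refl
  eqF-refl (suc v) = eqF-refl v
  open Relation.Binary.PropositionalEquality using (cong₂; cong)
  symC : ∀ u v → (not (eqF u v) ∧ not (adj G u v)) ≡ (not (eqF v u) ∧ not (adj G v u))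
  symC u v = cong₂ (λ a b → not a ∧ not b) (eqF-sym u v) (Graph.sym G u v)
  irr : ∀ v → (not (eqF v v) ∧ not (adj G v v)) ≡ false
  irr v = cong (λ a → not a ∧ not (adj G v v)) (eqF-refl v)

inClass : ∀ {n k} → (Fin n → Fin k) → Fin k → Fin n → Bool
inClass c i x = eqF (c x) i

classSize : ∀ {n k} → (Fin n → Fin k) → Fin k → ℕ
classSize c i = countF (inClass c i)

nbCount : ∀ {n k} → Graph n → (Fin n → Fin k) → Fin n → Fin k → ℕ
nbCount G c v i = countF (λ x → adj G v x ∧ inClass c i x)

closedNbCount : ∀ {n k} → Graph n → (Fin n → Fin k) → Fin n → Fin k → ℕ
closedNbCount G c v i = countF (λ x → (eqF v x ∨ adj G v x) ∧ inClass c i x)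

Surjective : ∀ {n k} → (Fin n → Fin k) → Set
Surjective {n} {k} c = ∀ (i : Fin k) → ∃ λ (x : Fin n) → c x ≡ i

IsNBColoring : ∀ {n k} → Graph n → (Fin n → Fin k) → Set
IsNBColoring {n} {k} G c =
  Surjective c × (∀ (v : Fin n) (i j : Fin k) → nbCount G c v i ≡ nbCount G c v j)

IsCNBColoring : ∀ {n k} → Graph n → (Fin n → Fin k) → Set
IsCNBColoring {n} {k} G c =
  ∀ (v : Fin n) (i j : Fin k) → closedNbCount G c v i ≡ closedNbCount G c v j

-- In the complement, the closed neighbourhood of v is exactly the set of
-- non-neighbours of v in G, so |N̄[v] ∩ Vᵢ| + |N(v) ∩ Vᵢ| = |Vᵢ|.  When all
-- classes have the same size, one of the two summands is independent of i
-- exactly when the other one is.  Surjectivity of c comes for free: the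
-- class of any vertex is non-empty, hence so are all classes.
module Submission where

open import Defs hiding (sym)
open import Data.Nat using (ℕ; zero; suc; _+_; _≤_; s≤s; z≤n)
open import Data.Nat.Properties using (+-suc; +-comm; +-cancelʳ-≡)
open import Data.Fin using (Fin; zero; suc)
open import Data.Bool using (Bool; true; false; not; _∧_; _∨_)
open import Data.Product using (∃; _,_)
open import Function.Bundles using (_⇔_; mk⇔)
open import Relation.Binary.PropositionalEquality
  using (_≡_; refl; sym; trans; cong; subst; module ≡-Reasoning)

eqF⇒≡ : ∀ {n} {a b : Fin n} → eqF a b ≡ true → a ≡ b
eqF⇒≡ {a = zero}  {zero}  _ = refl
eqF⇒≡ {a = suc a} {suc b} e = cong suc (eqF⇒≡ e)

eqF-refl : ∀ {n} (a : Fin n) → eqF a a ≡ true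
eqF-refl zero    = refl
eqF-refl (suc a) = eqF-refl a

countF-cong : ∀ {n} {p q : Fin n → Bool} → (∀ x → p x ≡ q x) → countF p ≡ countF q
countF-cong {zero}          _ = refl
countF-cong {suc n} {p} {q} h with p zero | q zero | h zero
... | true  | .true  | refl = cong suc (countF-cong (λ x → h (suc x)))
... | false | .false | refl = countF-cong (λ x → h (suc x))

countF-split : ∀ {n} (a p : Fin n → Bool) →
  countF (λ x → a x ∧ p x) + countF (λ x → not (a x) ∧ p x) ≡ countF p
countF-split {zero} a p = refl
countF-split {suc n} a p with a zero | p zero
... | true  | true  = cong suc (countF-split (λ i → a (suc i)) (λ i → p (suc i)))
... | true  | false = countF-split (λ i → a (suc i)) (λ i → p (suc i))
... | false | true  = trans (+-suc _ _)
                        (cong suc (countF-split (λ i → a (suc i)) (λ i → p (suc i))))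
... | false | false = countF-split (λ i → a (suc i)) (λ i → p (suc i))

countF-witness : ∀ {n} (p : Fin n → Bool) → 1 ≤ countF p → ∃ λ x → p x ≡ true
countF-witness {suc n} p h with p zero in eq
... | true  = zero , eq
... | false with countF-witness (λ i → p (suc i)) h
...   | x , e = suc x , e

equalClassSizes⇒surjective : ∀ {n k} (c : Fin (suc n) → Fin k) →
  (∀ i j → classSize c i ≡ classSize c j) → Surjective c
equalClassSizes⇒surjective c eqs i
  with countF-witness (inClass c i) (subst (1 ≤_) (eqs (c zero) i) own-class-inhabited)
  where
  own-class-inhabited : 1 ≤ classSize c (c zero)
  own-class-inhabited rewrite eqF-refl (c zero) = s≤s z≤n
... | x , e = x , eqF⇒≡ e

module _ {n : ℕ} (G : Graph n) where

  closedNb-complement≡nonNb : ∀ v x → (eqF v x ∨ adj (complement G) v x) ≡ not (adj G v x)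
  closedNb-complement≡nonNb v x with eqF v x in e
  ... | false = refl
  ... | true with refl ← eqF⇒≡ {a = v} {x} e rewrite irrefl G v = refl

  nbCount+closedNbCount-complement : ∀ {k} (c : Fin n → Fin k) v i →
    nbCount G c v i + closedNbCount (complement G) c v i ≡ classSize c i
  nbCount+closedNbCount-complement c v i = begin
    nbCount G c v i + closedNbCount (complement G) c v i
      ≡⟨ cong (nbCount G c v i +_)
           (countF-cong (λ x → cong (_∧ inClass c i x) (closedNb-complement≡nonNb v x))) ⟩
    nbCount G c v i + countF (λ x → not (adj G v x) ∧ inClass c i x)
      ≡⟨ countF-split (adj G v) (inClass c i) ⟩
    classSize c i ∎
    where open ≡-Reasoning

constant-summand : ∀ {k} {a b s : Fin k → ℕ} →
  (∀ i → a i + b i ≡ s i) → (∀ i j → s i ≡ s j) →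
  (∀ i j → a i ≡ a j) → ∀ i j → b i ≡ b j
constant-summand {a = a} {b} {s} sum eqs eqa i j =
  +-cancelʳ-≡ (a i) (b i) (b j) (begin
    b i + a i ≡⟨ +-comm (b i) (a i) ⟩
    a i + b i ≡⟨ sum i ⟩
    s i       ≡⟨ eqs i j ⟩
    s j       ≡⟨ sym (sum j) ⟩
    a j + b j ≡⟨ cong (_+ b j) (sym (eqa i j)) ⟩
    a i + b j ≡⟨ +-comm (a i) (b j) ⟩
    b j + a i ∎)
  where open ≡-Reasoning

theorem2p16 : (n k : ℕ) → 1 ≤ n → 2 ≤ k → (G : Graph n) → (c : Fin n → Fin k) →
    (∀ (i j : Fin k) → classSize c i ≡ classSize c j) →
    (IsNBColoring G c ⇔ IsCNBColoring (complement G) c)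
theorem2p16 (suc m) k _ _ G c eqs = mk⇔
  (λ (_ , nb) v → constant-summand (partition v) eqs (nb v))
  (λ cnb → equalClassSizes⇒surjective c eqs
         , λ v → constant-summand (partition′ v) eqs (cnb v))
  where
  partition : ∀ v i → nbCount G c v i + closedNbCount (complement G) c v i ≡ classSize c i
  partition = nbCount+closedNbCount-complement G c
  partition′ : ∀ v i → closedNbCount (complement G) c v i + nbCount G c v i ≡ classSize c i
  partition′ v i = trans (+-comm (closedNbCount (complement G) c v i) _) (partition v i)
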